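{- Let $k$ and $n$ be positive integers and let $\phi:E(K_n)\to[k]$ be any Gallai $k$-coloring of $K_n$. If $\phi':E(K_{n+1})\to[k]$ is a Gallai coloring of $K_{n+1}$ extending $\phi$ (where $K_n\subseteq K_{n+1}$), then \[ w(\phi',k)\le 2w(\phi,k)+(k-2). \]
   Context: An edge coloring of a complete graph is a Gallai coloring if it contains no triangle whose three edges have three distinct colors; a Gallai $k$-coloring uses colors from $[k]=\{1,\dots,k\}$ (not necessarily all). For a Gallai coloring $\psi$ of $E(K_m)$ with colors in $[k]$, $w(\psi,k)$ denotes the number of ways to extend $\psi$ to a Gallai coloring of $E(K_{m+1})$ (obtained by adding one new vertex joined to all vertices of $K_m$) in which the new edges receive colors from $[k]$. -}

module Defs where

open import Data.Nat using (ℕ; zero; suc; NonZero)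
open import Data.Fin using (Fin; zero; suc; _≟_)
open import Data.Fin.Properties using (all?)
open import Data.Vec using (Vec; []; _∷_; lookup; allFin; toList)
open import Data.List using (List; []; _∷_; concatMap; map; length; filter)
open import Data.Product using (_×_; _,_)
open import Relation.Nullary using (¬_; Dec)
open import Relation.Nullary.Decidable using (_×-dec_; ¬?)
open import Relation.Binary.PropositionalEquality using (_≡_; _≢_)

-- An edge colouring of K_m with colours in [k] = Fin k, given as a function on
-- ordered pairs of vertices.  Only the values at pairs of DISTINCT vertices are
-- meaningful (the diagonal values are junk and never inspected).
Coloring : ℕ → ℕ → Set
Coloring m k = Fin m → Fin m → Fin k

IsEdgeColoring : ∀ {m k} → Coloring m k → Set
IsEdgeColoring {m} c = ∀ (i j : Fin m) → i ≢ j → c i j ≡ c j i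

Rainbow : ∀ {m k} → Coloring m k → Fin m → Fin m → Fin m → Set
Rainbow c i j l =
  (i ≢ j) × (j ≢ l) × (i ≢ l) ×
  (c i j ≢ c j l) × (c j l ≢ c i l) × (c i j ≢ c i l)

rainbow? : ∀ {m k} (c : Coloring m k) i j l → Dec (Rainbow c i j l)
rainbow? c i j l =
  ¬? (i ≟ j) ×-dec ¬? (j ≟ l) ×-dec ¬? (i ≟ l) ×-dec
  ¬? (c i j ≟ c j l) ×-dec ¬? (c j l ≟ c i l) ×-dec ¬? (c i j ≟ c i l)

IsGallai : ∀ {m k} → Coloring m k → Set
IsGallai {m} c = ∀ (i j l : Fin m) → ¬ Rainbow c i j l

gallai? : ∀ {m k} (c : Coloring m k) → Dec (IsGallai c)
gallai? c = all? λ i → all? λ j → all? λ l → ¬? (rainbow? c i j l)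

-- K_{m+1} is K_m plus one new vertex.  We take the new vertex to be
-- zero : Fin (suc m), and the old vertex i of K_m to be suc i.
-- c' extends c: it agrees with c on every edge of K_m.
Extends : ∀ {m k} → Coloring (suc m) k → Coloring m k → Set
Extends {m} c' c = ∀ (i j : Fin m) → i ≢ j → c' (suc i) (suc j) ≡ c i j

-- Some colour (used only as a junk diagonal value).
someColour : ∀ k → .{{NonZero k}} → Fin k
someColour (suc k) = zero

extend : ∀ {m k} → .{{NonZero k}} → Coloring m k → Vec (Fin k) m → Coloring (suc m) k
extend {k = k} c f zero    zero    = someColour k
extend         c f zero    (suc j) = lookup f j
extend         c f (suc i) zero    = lookup f i
extend         c f (suc i) (suc j) = c i j

allVecs : ∀ m k → List (Vec (Fin k) m)
allVecs zero    k = [] ∷ []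
allVecs (suc m) k = concatMap (λ x → map (x ∷_) (allVecs m k)) (toList (allFin k))

w : ∀ {m} k → .{{NonZero k}} → Coloring m k → ℕ
w {m} k c = length (filter (λ f → gallai? (extend c f)) (allVecs m k))

-- Let s be the colouring that φ' gives to the edges from its new vertex to K_n,
-- and count the Gallai extensions of φ' by their restriction f to the edges
-- from the newest vertex to K_n.  Such an f must itself be a Gallai extension
-- of φ.  For f = s (which is a Gallai extension of φ, namely φ' itself) there
-- are at most k choices for the remaining edge between the two new vertices.
-- For f ≠ s, say f i ≠ s i, that edge closes a triangle with edges coloured
-- f i and s i, so it must take one of these two colours.  Hence
-- w(φ') ≤ k + 2 (w(φ) − 1).
module Submission where

open import Defs
open import Data.Bool using (if_then_else_)
open import Data.Empty using (⊥-elim)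
open import Data.Fin using (Fin; _≟_; punchIn) renaming (zero to fzero; suc to fsuc)
open import Data.Fin.Properties using (punchIn-injective)
open import Data.List using (List; []; _∷_; concatMap; map; length; filter; _++_)
open import Data.Nat using (ℕ; zero; suc; _+_; _*_; _≤_; z≤n; s≤s; NonZero)
open import Data.Nat.Properties
  using (+-identityʳ; +-assoc; +-comm; *-zeroʳ; *-identityʳ; *-distribˡ-+;
         +-mono-≤; +-monoʳ-≤; ≤-trans; ≤-reflexive; +-commutativeSemigroup; module ≤-Reasoning)
open import Algebra.Properties.CommutativeSemigroup +-commutativeSemigroup using (interchange)
open import Data.Product using (_,_; ∃)
open import Data.Sum using (_⊎_; inj₁; inj₂)
open import Data.Vec using (Vec; []; _∷_; lookup; allFin; toList; tabulate)
import Data.Vec as Vec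
open import Data.Vec.Properties
  using (≡-dec; lookup∘tabulate; tabulate-allFin; toList-map; length-toList)
open import Function using (_∘_; id)
open import Function.Definitions using (Injective)
open import Relation.Binary.Definitions using (DecidableEquality)
open import Relation.Binary.PropositionalEquality
open import Relation.Nullary using (¬_; Dec; yes; no; does; _×-dec_)

∑ : ∀ {A : Set} → List A → (A → ℕ) → ℕ
∑ []       g = 0
∑ (x ∷ xs) g = g x + ∑ xs g

module _ {A : Set} where

  ∑-cong : ∀ (xs : List A) {f g : A → ℕ} → (∀ a → f a ≡ g a) → ∑ xs f ≡ ∑ xs g
  ∑-cong []       f≗g = refl
  ∑-cong (x ∷ xs) f≗g = cong₂ _+_ (f≗g x) (∑-cong xs f≗g)

  ∑-zero : ∀ (xs : List A) → ∑ xs (λ _ → 0) ≡ 0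
  ∑-zero []       = refl
  ∑-zero (x ∷ xs) = ∑-zero xs

  ∑-+ : ∀ (xs : List A) f g → ∑ xs (λ a → f a + g a) ≡ ∑ xs f + ∑ xs g
  ∑-+ []       f g = refl
  ∑-+ (x ∷ xs) f g =
    trans (cong (f x + g x +_) (∑-+ xs f g)) (interchange (f x) (g x) (∑ xs f) (∑ xs g))

  ∑-*ˡ : ∀ (xs : List A) c f → ∑ xs (λ a → c * f a) ≡ c * ∑ xs f
  ∑-*ˡ []       c f = sym (*-zeroʳ c)
  ∑-*ˡ (x ∷ xs) c f =
    trans (cong (c * f x +_) (∑-*ˡ xs c f)) (sym (*-distribˡ-+ c (f x) (∑ xs f)))

  ∑-+-*ˡ : ∀ (xs : List A) f c g → ∑ xs (λ a → f a + c * g a) ≡ ∑ xs f + c * ∑ xs g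
  ∑-+-*ˡ xs f c g = trans (∑-+ xs f _) (cong (∑ xs f +_) (∑-*ˡ xs c g))

  ∑-mono-≤ : ∀ (xs : List A) {f g : A → ℕ} → (∀ a → f a ≤ g a) → ∑ xs f ≤ ∑ xs g
  ∑-mono-≤ []       f≤g = z≤n
  ∑-mono-≤ (x ∷ xs) f≤g = +-mono-≤ (f≤g x) (∑-mono-≤ xs f≤g)

  ∑-≤-length : ∀ (xs : List A) {f : A → ℕ} → (∀ a → f a ≤ 1) → ∑ xs f ≤ length xs
  ∑-≤-length []       f≤1 = z≤n
  ∑-≤-length (x ∷ xs) f≤1 = +-mono-≤ (f≤1 x) (∑-≤-length xs f≤1)

  ∑-++ : ∀ (xs ys : List A) g → ∑ (xs ++ ys) g ≡ ∑ xs g + ∑ ys g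
  ∑-++ []       ys g = refl
  ∑-++ (x ∷ xs) ys g = trans (cong (g x +_) (∑-++ xs ys g)) (sym (+-assoc (g x) _ _))

module _ {A B : Set} where

  ∑-map : ∀ (h : A → B) (xs : List A) g → ∑ (map h xs) g ≡ ∑ xs (g ∘ h)
  ∑-map h []       g = refl
  ∑-map h (x ∷ xs) g = cong (g (h x) +_) (∑-map h xs g)

  ∑-concatMap : ∀ (F : A → List B) (xs : List A) g →
    ∑ (concatMap F xs) g ≡ ∑ xs (λ a → ∑ (F a) g)
  ∑-concatMap F []       g = refl
  ∑-concatMap F (x ∷ xs) g =
    trans (∑-++ (F x) (concatMap F xs) g) (cong (∑ (F x) g +_) (∑-concatMap F xs g))

  ∑-swap : ∀ (xs : List A) (ys : List B) (G : A → B → ℕ) →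
    ∑ xs (λ a → ∑ ys (G a)) ≡ ∑ ys (λ b → ∑ xs (λ a → G a b))
  ∑-swap []       ys G = sym (∑-zero ys)
  ∑-swap (x ∷ xs) ys G =
    trans (cong (∑ ys (G x) +_) (∑-swap xs ys G)) (sym (∑-+ ys (G x) _))

-- Defined through 'does' so that 𝟙 (suc x ≟ suc y) reduces to 𝟙 (x ≟ y).
𝟙 : ∀ {P : Set} → Dec P → ℕ
𝟙 P? = if does P? then 1 else 0

module _ {P : Set} where

  𝟙≤1 : (P? : Dec P) → 𝟙 P? ≤ 1
  𝟙≤1 (yes _) = s≤s z≤n
  𝟙≤1 (no _)  = z≤n

  𝟙-yes : (P? : Dec P) → P → 𝟙 P? ≡ 1
  𝟙-yes (yes _) p  = refl
  𝟙-yes (no ¬p) p  = ⊥-elim (¬p p)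

  𝟙-no : (P? : Dec P) → ¬ P → 𝟙 P? ≡ 0
  𝟙-no (yes p) ¬p = ⊥-elim (¬p p)
  𝟙-no (no _)  ¬p = refl

  𝟙-×-dec : ∀ {Q : Set} (P? : Dec P) (Q? : Dec Q) → 𝟙 (P? ×-dec Q?) ≡ 𝟙 P? * 𝟙 Q?
  𝟙-×-dec (yes _) Q? = sym (+-identityʳ (𝟙 Q?))
  𝟙-×-dec (no _)  Q? = refl

  𝟙-≤-⊎ : ∀ {Q R : Set} (P? : Dec P) (Q? : Dec Q) (R? : Dec R) →
    (P → Q ⊎ R) → 𝟙 P? ≤ 𝟙 Q? + 𝟙 R?
  𝟙-≤-⊎ (no _)  Q?      R?      P⇒Q⊎R = z≤n
  𝟙-≤-⊎ (yes p) (yes _) R?      P⇒Q⊎R = s≤s z≤n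
  𝟙-≤-⊎ (yes p) (no ¬q) (yes _) P⇒Q⊎R = s≤s z≤n
  𝟙-≤-⊎ (yes p) (no ¬q) (no ¬r) P⇒Q⊎R with P⇒Q⊎R p
  ... | inj₁ q = ⊥-elim (¬q q)
  ... | inj₂ r = ⊥-elim (¬r r)

length-filter≡∑𝟙 : ∀ {A : Set} {P : A → Set} (P? : ∀ x → Dec (P x)) xs →
  length (filter P? xs) ≡ ∑ xs (𝟙 ∘ P?)
length-filter≡∑𝟙 P? []       = refl
length-filter≡∑𝟙 P? (x ∷ xs) with P? x
... | yes _ = cong suc (length-filter≡∑𝟙 P? xs)
... | no _  = length-filter≡∑𝟙 P? xs

colours : ∀ k → List (Fin k)
colours k = toList (allFin k)

∑-colours-suc : ∀ k g → ∑ (colours (suc k)) g ≡ g fzero + ∑ (colours k) (g ∘ fsuc)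
∑-colours-suc k g = cong (g fzero +_) (begin
  ∑ (toList (tabulate fsuc)) g           ≡⟨ cong (λ cs → ∑ (toList cs) g) (tabulate-allFin fsuc) ⟩
  ∑ (toList (Vec.map fsuc (allFin k))) g ≡⟨ cong (λ cs → ∑ cs g) (toList-map fsuc (allFin k)) ⟩
  ∑ (map fsuc (colours k)) g             ≡⟨ ∑-map fsuc (colours k) g ⟩
  ∑ (colours k) (g ∘ fsuc)               ∎)
  where open ≡-Reasoning

length-colours : ∀ k → length (colours k) ≡ k
length-colours k = length-toList (allFin k)

∑-colours-𝟙≡ : ∀ k (a : Fin k) → ∑ (colours k) (λ x → 𝟙 (x ≟ a)) ≡ 1
∑-colours-𝟙≡ (suc k) fzero    =
  trans (∑-colours-suc k (λ x → 𝟙 (x ≟ fzero))) (cong suc (∑-zero (colours k)))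
∑-colours-𝟙≡ (suc k) (fsuc a) =
  trans (∑-colours-suc k (λ x → 𝟙 (x ≟ fsuc a))) (∑-colours-𝟙≡ k a)

module _ {A : Set} (_≟ᴬ_ : DecidableEquality A) where

  lookup-≢ : ∀ {m} (f v : Vec A m) → f ≢ v → ∃ λ i → lookup f i ≢ lookup v i
  lookup-≢ []      []      []≢[] = ⊥-elim ([]≢[] refl)
  lookup-≢ (x ∷ f) (y ∷ v) x∷f≢y∷v with x ≟ᴬ y
  ... | no x≢y    = fzero , x≢y
  ... | yes refl with lookup-≢ f v (x∷f≢y∷v ∘ cong (x ∷_))
  ...   | i , fᵢ≢vᵢ = fsuc i , fᵢ≢vᵢ

infix 4 _≟ᵥ_

_≟ᵥ_ : ∀ {m k} → DecidableEquality (Vec (Fin k) m)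
_≟ᵥ_ = ≡-dec _≟_

∑-allVecs-suc : ∀ m k g →
  ∑ (allVecs (suc m) k) g ≡ ∑ (colours k) (λ x → ∑ (allVecs m k) (λ f → g (x ∷ f)))
∑-allVecs-suc m k g =
  trans (∑-concatMap _ (colours k) g) (∑-cong (colours k) (λ x → ∑-map (x ∷_) (allVecs m k) g))

∑-allVecs-𝟙≡ : ∀ m k (v : Vec (Fin k) m) → ∑ (allVecs m k) (λ f → 𝟙 (f ≟ᵥ v)) ≡ 1
∑-allVecs-𝟙≡ zero    k []      = refl
∑-allVecs-𝟙≡ (suc m) k (a ∷ v) = begin
  ∑ (allVecs (suc m) k) (λ f → 𝟙 (f ≟ᵥ a ∷ v))
    ≡⟨ ∑-allVecs-suc m k _ ⟩
  ∑ (colours k) (λ x → ∑ (allVecs m k) (λ f → 𝟙 (x ∷ f ≟ᵥ a ∷ v)))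
    ≡⟨ ∑-cong (colours k) (λ x → ∑-cong (allVecs m k) (λ f → 𝟙-×-dec (x ≟ a) (f ≟ᵥ v))) ⟩
  ∑ (colours k) (λ x → ∑ (allVecs m k) (λ f → 𝟙 (x ≟ a) * 𝟙 (f ≟ᵥ v)))
    ≡⟨ ∑-cong (colours k) (λ x → ∑-*ˡ (allVecs m k) (𝟙 (x ≟ a)) _) ⟩
  ∑ (colours k) (λ x → 𝟙 (x ≟ a) * ∑ (allVecs m k) (λ f → 𝟙 (f ≟ᵥ v)))
    ≡⟨ ∑-cong (colours k) (λ x → cong (𝟙 (x ≟ a) *_) (∑-allVecs-𝟙≡ m k v)) ⟩
  ∑ (colours k) (λ x → 𝟙 (x ≟ a) * 1)
    ≡⟨ ∑-cong (colours k) (λ x → *-identityʳ (𝟙 (x ≟ a))) ⟩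
  ∑ (colours k) (λ x → 𝟙 (x ≟ a))
    ≡⟨ ∑-colours-𝟙≡ k a ⟩
  1 ∎
  where open ≡-Reasoning

module _ {m k : ℕ} {c : Coloring m k} where

  IsGallai-restrict : ∀ {m′} {c′ : Coloring m′ k} (e : Fin m → Fin m′) → Injective _≡_ _≡_ e →
    (∀ a b → a ≢ b → c′ (e a) (e b) ≡ c a b) → IsGallai c′ → IsGallai c
  IsGallai-restrict e e-inj c′∘e≡c gallai a b d (a≢b , b≢d , a≢d , ab≢bd , bd≢ad , ab≢ad) =
    gallai (e a) (e b) (e d)
      ( a≢b ∘ e-inj , b≢d ∘ e-inj , a≢d ∘ e-inj
      , (λ eq → ab≢bd (trans (sym (c′∘e≡c a b a≢b)) (trans eq (c′∘e≡c b d b≢d))))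
      , (λ eq → bd≢ad (trans (sym (c′∘e≡c b d b≢d)) (trans eq (c′∘e≡c a d a≢d))))
      , (λ eq → ab≢ad (trans (sym (c′∘e≡c a b a≢b)) (trans eq (c′∘e≡c a d a≢d)))) )

  IsGallai-triangle : IsGallai c → ∀ {i j l} → i ≢ j → j ≢ l → i ≢ l →
    c j l ≢ c i l → c i j ≡ c j l ⊎ c i j ≡ c i l
  IsGallai-triangle gallai {i} {j} {l} i≢j j≢l i≢l jl≢il with c i j ≟ c j l | c i j ≟ c i l
  ... | yes ij≡jl | _         = inj₁ ij≡jl
  ... | no _      | yes ij≡il = inj₂ ij≡il
  ... | no ij≢jl  | no ij≢il  = ⊥-elim (gallai i j l (i≢j , j≢l , i≢l , ij≢jl , jl≢il , ij≢il))

module GallaiExtension (k n : ℕ) .{{_ : NonZero k}} (φ : Coloring n k) (φ′ : Coloring (suc n) k)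
  (φ′-edge : IsEdgeColoring φ′) (φ′-gallai : IsGallai φ′) (φ′-extends : Extends φ′ φ) where

  s : Vec (Fin k) n
  s = tabulate (φ′ fzero ∘ fsuc)

  lookup-s : ∀ i → lookup s i ≡ φ′ fzero (fsuc i)
  lookup-s = lookup∘tabulate (φ′ fzero ∘ fsuc)

  IsGallai-extend-s : IsGallai (extend φ s)
  IsGallai-extend-s = IsGallai-restrict id id φ′≡extend-s φ′-gallai
    where
    φ′≡extend-s : ∀ a b → a ≢ b → φ′ a b ≡ extend φ s a b
    φ′≡extend-s fzero    fzero    0≢0 = ⊥-elim (0≢0 refl)
    φ′≡extend-s fzero    (fsuc j) _   = sym (lookup-s j)
    φ′≡extend-s (fsuc i) fzero    _   = trans (φ′-edge (fsuc i) fzero (λ ())) (sym (lookup-s i))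
    φ′≡extend-s (fsuc i) (fsuc j) i≢j = φ′-extends i j (i≢j ∘ cong fsuc)

  -- punchIn (fsuc fzero) skips fsuc fzero, the vertex that φ′ adds to K_n.
  IsGallai-extend-tail : ∀ x f → IsGallai (extend φ′ (x ∷ f)) → IsGallai (extend φ f)
  IsGallai-extend-tail x f =
    IsGallai-restrict (punchIn (fsuc fzero)) (punchIn-injective (fsuc fzero) _ _) agree
    where
    agree : ∀ a b → a ≢ b → extend φ′ (x ∷ f) (punchIn (fsuc fzero) a) (punchIn (fsuc fzero) b)
                          ≡ extend φ f a b
    agree fzero    fzero    0≢0 = ⊥-elim (0≢0 refl)
    agree fzero    (fsuc j) _   = refl
    agree (fsuc i) fzero    _   = refl
    agree (fsuc i) (fsuc j) i≢j = φ′-extends i j (i≢j ∘ cong fsuc)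

  goodExtensions : Vec (Fin k) n → ℕ
  goodExtensions f = ∑ (colours k) (λ x → 𝟙 (gallai? (extend φ′ (x ∷ f))))

  goodExtensions≤k : ∀ f → goodExtensions f ≤ k
  goodExtensions≤k f =
    ≤-trans (∑-≤-length (colours k) (λ x → 𝟙≤1 (gallai? (extend φ′ (x ∷ f)))))
            (≤-reflexive (length-colours k))

  goodExtensions≡0 : ∀ f → ¬ IsGallai (extend φ f) → goodExtensions f ≡ 0
  goodExtensions≡0 f ¬gallai =
    trans (∑-cong (colours k) (λ x → 𝟙-no (gallai? _) (¬gallai ∘ IsGallai-extend-tail x f)))
          (∑-zero (colours k))

  goodExtensions≤2 : ∀ f → f ≢ s → goodExtensions f ≤ 2
  goodExtensions≤2 f f≢s with lookup-≢ _≟_ f s f≢s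
  ... | i , fᵢ≢sᵢ = begin
    goodExtensions f
      ≤⟨ ∑-mono-≤ (colours k) (λ x → 𝟙-≤-⊎ (gallai? _) (x ≟ φ′ fzero (fsuc i)) (x ≟ lookup f i)
                                             (forced x)) ⟩
    ∑ (colours k) (λ x → 𝟙 (x ≟ φ′ fzero (fsuc i)) + 𝟙 (x ≟ lookup f i))
      ≡⟨ ∑-+ (colours k) _ _ ⟩
    ∑ (colours k) (λ x → 𝟙 (x ≟ φ′ fzero (fsuc i))) + ∑ (colours k) (λ x → 𝟙 (x ≟ lookup f i))
      ≡⟨ cong₂ _+_ (∑-colours-𝟙≡ k _) (∑-colours-𝟙≡ k _) ⟩
    2 ∎
    where
    open ≤-Reasoning
    forced : ∀ x → IsGallai (extend φ′ (x ∷ f)) → x ≡ φ′ fzero (fsuc i) ⊎ x ≡ lookup f i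
    forced x gallai = IsGallai-triangle gallai {fzero} {fsuc fzero} {fsuc (fsuc i)}
      (λ ()) (λ ()) (λ ()) (λ eq → fᵢ≢sᵢ (trans (sym eq) (sym (lookup-s i))))

  goodExtensions-bound : ∀ f →
    goodExtensions f + 2 * 𝟙 (f ≟ᵥ s) ≤ 2 * 𝟙 (gallai? (extend φ f)) + k * 𝟙 (f ≟ᵥ s)
  goodExtensions-bound f with f ≟ᵥ s
  ... | yes refl = begin
    goodExtensions s + 2  ≡⟨ +-comm (goodExtensions s) 2 ⟩
    2 + goodExtensions s  ≤⟨ +-monoʳ-≤ 2 (goodExtensions≤k s) ⟩
    2 + k                 ≡⟨ cong₂ _+_ (cong (2 *_) (sym (𝟙-yes (gallai? _) IsGallai-extend-s)))
                                       (sym (*-identityʳ k)) ⟩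
    2 * 𝟙 (gallai? (extend φ s)) + k * 1 ∎
    where open ≤-Reasoning
  ... | no f≢s = begin
    goodExtensions f + 0                  ≡⟨ +-identityʳ (goodExtensions f) ⟩
    goodExtensions f                      ≤⟨ goodExtensions≤2·𝟙 (gallai? (extend φ f)) ⟩
    2 * 𝟙 (gallai? (extend φ f))          ≡⟨ sym (+-identityʳ _) ⟩
    2 * 𝟙 (gallai? (extend φ f)) + 0      ≡⟨ cong (2 * 𝟙 (gallai? (extend φ f)) +_) (sym (*-zeroʳ k)) ⟩
    2 * 𝟙 (gallai? (extend φ f)) + k * 0  ∎
    where
    open ≤-Reasoning
    goodExtensions≤2·𝟙 : (gallai-f? : Dec (IsGallai (extend φ f))) → goodExtensions f ≤ 2 * 𝟙 gallai-f?
    goodExtensions≤2·𝟙 (yes _)      = goodExtensions≤2 f f≢s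
    goodExtensions≤2·𝟙 (no ¬gallai) = ≤-reflexive (goodExtensions≡0 f ¬gallai)

  w-φ′≡∑ : w k φ′ ≡ ∑ (allVecs n k) goodExtensions
  w-φ′≡∑ = begin
    w k φ′
      ≡⟨ length-filter≡∑𝟙 _ (allVecs (suc n) k) ⟩
    ∑ (allVecs (suc n) k) (𝟙 ∘ gallai? ∘ extend φ′)
      ≡⟨ ∑-allVecs-suc n k _ ⟩
    ∑ (colours k) (λ x → ∑ (allVecs n k) (λ f → 𝟙 (gallai? (extend φ′ (x ∷ f)))))
      ≡⟨ ∑-swap (colours k) (allVecs n k) _ ⟩
    ∑ (allVecs n k) goodExtensions ∎
    where open ≡-Reasoning

  w-φ≡∑ : w k φ ≡ ∑ (allVecs n k) (𝟙 ∘ gallai? ∘ extend φ)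
  w-φ≡∑ = length-filter≡∑𝟙 _ (allVecs n k)

lemma2p2 : (k n : ℕ) → .{{_ : NonZero k}} → .{{_ : NonZero n}} →
    (φ : Coloring n k) → IsEdgeColoring φ → IsGallai φ →
    (φ' : Coloring (suc n) k) → IsEdgeColoring φ' → IsGallai φ' → Extends φ' φ →
    w k φ' + 2 ≤ 2 * w k φ + k
lemma2p2 k n φ _ _ φ′ φ′-edge φ′-gallai φ′-extends = begin
  w k φ′ + 2
    ≡⟨ cong₂ _+_ w-φ′≡∑ (cong (2 *_) (sym (∑-allVecs-𝟙≡ n k s))) ⟩
  ∑ Fs goodExtensions + 2 * ∑ Fs (λ f → 𝟙 (f ≟ᵥ s))
    ≡⟨ sym (∑-+-*ˡ Fs goodExtensions 2 _) ⟩
  ∑ Fs (λ f → goodExtensions f + 2 * 𝟙 (f ≟ᵥ s))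
    ≤⟨ ∑-mono-≤ Fs goodExtensions-bound ⟩
  ∑ Fs (λ f → 2 * 𝟙 (gallai? (extend φ f)) + k * 𝟙 (f ≟ᵥ s))
    ≡⟨ ∑-+-*ˡ Fs _ k _ ⟩
  ∑ Fs (λ f → 2 * 𝟙 (gallai? (extend φ f))) + k * ∑ Fs (λ f → 𝟙 (f ≟ᵥ s))
    ≡⟨ cong₂ _+_ (trans (∑-*ˡ Fs 2 _) (cong (2 *_) (sym w-φ≡∑)))
                 (trans (cong (k *_) (∑-allVecs-𝟙≡ n k s)) (*-identityʳ k)) ⟩
  2 * w k φ + k ∎
  where
  open GallaiExtension k n φ φ′ φ′-edge φ′-gallai φ′-extends
  open ≤-Reasoning
  Fs : List (Vec (Fin k) n)
  Fs = allVecs n k
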